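{- Let $G$ be a finite graph, let $r,s$ be two crossing separations of $G$ each of which lies in some entanglement in $G$, and let $c,d$ be two opposite corners of $r,s$. Then $x(c)+x(d)<x(r)+x(s)$.
   Context: A separation of a graph $G$ is a set $\{A,B\}$ with $A\cup B=V(G)$ such that $G$ has no edge between $A\setminus B$ and $B\setminus A$; its order is $|A\cap B|$; it is proper if $A\setminus B,B\setminus A\neq\emptyset$. Two separations $\{A,B\},\{C,D\}$ are nested if, after possibly renaming sides, $A\subseteq C$ and $B\supseteq D$; otherwise they cross. For crossing $\{A,B\},\{C,D\}$ the four corners are $\{A\cap C,B\cup D\}$, $\{A\cap D,B\cup C\}$, $\{B\cap D,A\cup C\}$, $\{B\cap C,A\cup D\}$; $\{A\cap C,B\cup D\}$ and $\{B\cap D,A\cup C\}$ are opposite, and $\{A\cap D,B\cup C\}$ and $\{B\cap C,A\cup D\}$ are opposite. The first two corners in the list lie on the same side of $\{A,B\}$, as do the last two. An entanglement in $G$ is a non-empty set $\varepsilon$ of proper separations such that: if $\{A,B\}\in\varepsilon$ is crossed by a separation of $G$ so that two corners lying on the same side of $\{A,B\}$ have order at most $|A\cap B|$, then at least one of them has order equal to $|A\cap B|$ and lies in $\varepsilon$. For a separation $s$, $x(s)$ is the number of separations lying in (at least one) entanglement in $G$ that are crossed by $s$. -}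

module Defs where

open import Level using (0ℓ)
open import Data.Nat using (ℕ; _≤_)
open import Data.Bool using (Bool; true; false)
open import Data.Fin using (Fin)
open import Data.Fin.Subset using (Subset; _∈_; _∉_; _⊆_; _∩_; _∪_; ⊤; ∣_∣)
open import Data.Product using (Σ; ∃; _×_; _,_; proj₁; proj₂; swap)
open import Data.Sum using (_⊎_)
open import Data.List using (List; length)
open import Data.List.Relation.Unary.All using (All)
open import Data.List.Relation.Unary.AllPairs using (AllPairs)
open import Data.List.Membership.Propositional using () renaming (_∈_ to _∈ₗ_)
open import Relation.Nullary using (¬_)
open import Relation.Binary.PropositionalEquality using (_≡_)

record Graph (n : ℕ) : Set where
  field
    adj   : Fin n → Fin n → Bool
    sym   : ∀ u v → adj u v ≡ adj v u
    irrefl : ∀ v → adj v v ≡ false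
open Graph public

-- An (unordered) separation {A,B} is represented by an ordered pair (A , B);
-- (A , B) and (B , A) represent the same separation.
Pair : ℕ → Set
Pair n = Subset n × Subset n

IsSep : ∀ {n} → Graph n → Pair n → Set
IsSep G (A , B) =
  (A ∪ B ≡ ⊤) ×
  (∀ u v → u ∈ A → u ∉ B → v ∈ B → v ∉ A → adj G u v ≡ false)

order : ∀ {n} → Pair n → ℕ
order (A , B) = ∣ A ∩ B ∣

Proper : ∀ {n} → Pair n → Set
Proper (A , B) = (∃ λ v → v ∈ A × v ∉ B) × (∃ λ v → v ∈ B × v ∉ A)

Nested : ∀ {n} → Pair n → Pair n → Set
Nested (A , B) (C , D) =
  (A ⊆ C × D ⊆ B) ⊎ (B ⊆ C × D ⊆ A) ⊎ (A ⊆ D × C ⊆ B) ⊎ (B ⊆ D × C ⊆ A)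

Crosses : ∀ {n} → Pair n → Pair n → Set
Crosses r s = ¬ Nested r s

Opposite : ∀ {n} → Pair n → Pair n → Pair n → Pair n → Set
Opposite (A , B) (C , D) c d =
  (c ≡ (A ∩ C , B ∪ D) × d ≡ (B ∩ D , A ∪ C)) ⊎
  (c ≡ (B ∩ D , A ∪ C) × d ≡ (A ∩ C , B ∪ D)) ⊎
  (c ≡ (A ∩ D , B ∪ C) × d ≡ (B ∩ C , A ∪ D)) ⊎
  (c ≡ (B ∩ C , A ∪ D) × d ≡ (A ∩ D , B ∪ C))

-- A set of separations is a predicate on pairs; {A,B} lies in ε if
-- (A , B) or (B , A) satisfies it.
SepSet : ℕ → Set₁
SepSet n = Pair n → Set

InS : ∀ {n} → SepSet n → Pair n → Set
InS ε t = ε t ⊎ ε (swap t)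

-- Entanglement. The condition is stated for the side A of {A,B}; the side B
-- is covered since {A,B} ∈ ε is quantified over both orientations.
IsEntanglement : ∀ {n} → Graph n → SepSet n → Set
IsEntanglement G ε =
  (∃ λ t → InS ε t) ×
  (∀ t → InS ε t → IsSep G t × Proper t) ×
  (∀ A B C D → InS ε (A , B) → IsSep G (C , D) → Crosses (A , B) (C , D) →
     order (A ∩ C , B ∪ D) ≤ order (A , B) →
     order (A ∩ D , B ∪ C) ≤ order (A , B) →
     (order (A ∩ C , B ∪ D) ≡ order (A , B) × InS ε (A ∩ C , B ∪ D)) ⊎
     (order (A ∩ D , B ∪ C) ≡ order (A , B) × InS ε (A ∩ D , B ∪ C)))

InSomeEntanglement : ∀ {n} → Graph n → Pair n → Set₁
InSomeEntanglement {n} G t = Σ (SepSet n) λ ε → IsEntanglement G ε × InS ε t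

SameSep : ∀ {n} → Pair n → Pair n → Set
SameSep t u = t ≡ u ⊎ swap t ≡ u

-- XIs G s k : "x(s) = k", i.e. k is the number of (unordered) separations
-- lying in some entanglement in G that are crossed by s.  Witnessed by a list
-- containing exactly one representative of each such separation.
XIs : ∀ {n} → Graph n → Pair n → ℕ → Set₁
XIs G s k = Σ (List (Pair _)) λ L →
  All (λ t → InSomeEntanglement G t × Crosses s t) L ×
  (∀ t → InSomeEntanglement G t → Crosses s t → t ∈ₗ L ⊎ swap t ∈ₗ L) ×
  AllPairs (λ t u → ¬ SameSep t u) L ×
  length L ≡ k

-- Orient separations by (A , B) ≼ (C , D) iff A ⊆ C and D ⊆ B. The corners of crossing r and s
-- are then the meets r ∧ s, r ∧ s*, r* ∧ s, r* ∧ s* (s* the reversed orientation), and an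
-- opposite pair is {r ∧ s , r* ∧ s*} up to reorienting s. A separation nested with both r and s
-- is nested with r ∧ s, and one nested with r is nested with r ∧ s or with r* ∧ s*. Hence
-- everything crossed by a corner is crossed by r or s, and everything crossed by both opposite
-- corners is crossed by both r and s; so the crossing sets satisfy X(c) ∪ X(d) ⊆ X(r) ∪ X(s)
-- and X(c) ∩ X(d) ⊆ X(r) ∩ X(s). Inclusion–exclusion gives x(c) + x(d) ≤ x(r) + x(s), and
-- the inequality is strict because r ∈ X(s) while r, being nested with both corners, is in
-- neither X(c) nor X(d).
module Submission where

open import Defs hiding (sym)
open import Data.Nat using (ℕ; suc; _+_; _≤_; _<_; z≤n; s≤s)
open import Data.Nat.Properties
  using (+-suc; +-assoc; +-comm; +-mono-≤; +-mono-<-≤; module ≤-Reasoning)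
open import Data.Bool using (true; false)
open import Data.Bool.Properties using () renaming (_≟_ to Bool-≟)
open import Data.Vec.Properties using () renaming (≡-dec to Vec-≡-dec)
open import Data.Product.Properties using () renaming (≡-dec to ×-≡-dec)
open import Data.List using (List; []; _∷_; _++_; length; filter)
open import Data.List.Properties using (length-++)
open import Data.List.Relation.Unary.All as All using (All)
open import Data.List.Relation.Unary.Any as Any using (here; there)
open import Data.Product using (_×_; _,_; proj₁; proj₂; swap; map₂)
import Data.Product as Product
open import Data.Sum using (_⊎_; inj₁; inj₂; [_,_])
import Data.Sum as Sum
open import Relation.Binary using (DecSetoid; _Respects_)
open import Relation.Nullary using (¬_; Dec; yes; no; does; contradiction)
open import Relation.Nullary.Decidable using (_×-dec_; _⊎-dec_)
open import Relation.Unary using (Pred; Decidable)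
open import Relation.Unary.Properties using (∁?)
open import Relation.Binary.PropositionalEquality
  using (_≡_; refl; sym; trans; cong; subst; module ≡-Reasoning)

module UniqueCounting {c ℓ} (S : DecSetoid c ℓ) where

  open DecSetoid S using (_≈_; _≟_; setoid)
    renaming (Carrier to A; refl to ≈-refl; sym to ≈-sym; trans to ≈-trans)
  open import Data.List.Membership.DecSetoid S using (_∈_; _∉_; _∈?_)
  open import Data.List.Membership.Setoid.Properties
    using (∈-filter⁺; ∈-filter⁻; ∈-resp-≈; ∉-resp-≈; ∉⇒All[≉]; ∈-++⁺ˡ; ∈-++⁺ʳ; ∈-++⁻)
  open import Data.List.Relation.Unary.Unique.Setoid setoid using (Unique; []; _∷_)
  import Data.List.Relation.Unary.Unique.Setoid.Properties as Unique

  length-filter+length-filter-∁ : ∀ {p} {P : Pred A p} (P? : Decidable P) xs →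
    length (filter P? xs) + length (filter (∁? P?) xs) ≡ length xs
  length-filter+length-filter-∁ P? [] = refl
  length-filter+length-filter-∁ P? (x ∷ xs) with does (P? x)
  ... | true  = cong suc (length-filter+length-filter-∁ P? xs)
  ... | false = trans (+-suc _ _) (cong suc (length-filter+length-filter-∁ P? xs))

  Unique∧All≈⇒length≤1 : ∀ {y xs} → Unique xs → All (_≈ y) xs → length xs ≤ 1
  Unique∧All≈⇒length≤1 []                   _                         = z≤n
  Unique∧All≈⇒length≤1 (_ ∷ [])             _                         = s≤s z≤n
  Unique∧All≈⇒length≤1 ((x≉x′ All.∷ _) ∷ _) (x≈y All.∷ x′≈y All.∷ _) =
    contradiction (≈-trans x≈y (≈-sym x′≈y)) x≉x′

  -- Pigeonhole: strip the (at most one) entry of xs equivalent to the head of ys.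
  Unique⇒length≤ : ∀ {xs} ys → Unique xs → (∀ {t} → t ∈ xs → t ∈ ys) → length xs ≤ length ys
  Unique⇒length≤ {[]}    _        _   _     = z≤n
  Unique⇒length≤ {_ ∷ _} []       _   xs⊆[] with () ← xs⊆[] (here ≈-refl)
  Unique⇒length≤ {xs}    (y ∷ ys) xs! xs⊆ = begin
    length xs
      ≡⟨ sym (length-filter+length-filter-∁ (_≟ y) xs) ⟩
    length (filter (_≟ y) xs) + length (filter (∁? (_≟ y)) xs)
      ≤⟨ +-mono-≤ at-most-one rest-fits ⟩
    1 + length ys ∎
    where
    open ≤-Reasoning
    ≈y-resp : ∀ {u v} → u ≈ v → u ≈ y → v ≈ y
    ≈y-resp u≈v u≈y = ≈-trans (≈-sym u≈v) u≈y
    ≉y-resp : ∀ {u v} → u ≈ v → ¬ u ≈ y → ¬ v ≈ y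
    ≉y-resp u≈v u≉y v≈y = u≉y (≈-trans u≈v v≈y)
    at-most-one : length (filter (_≟ y) xs) ≤ 1
    at-most-one = Unique∧All≈⇒length≤1 (Unique.filter⁺ setoid (_≟ y) xs!)
      (All.tabulateₛ setoid λ t∈ → proj₂ (∈-filter⁻ setoid (_≟ y) ≈y-resp {xs = xs} t∈))
    rest-fits : length (filter (∁? (_≟ y)) xs) ≤ length ys
    rest-fits = Unique⇒length≤ ys (Unique.filter⁺ setoid (∁? (_≟ y)) xs!) λ t∈ →
      let t∈xs , t≉y = ∈-filter⁻ setoid (∁? (_≟ y)) ≉y-resp t∈ in Any.tail t≉y (xs⊆ t∈xs)

  infixr 6 _∪_
  infixr 7 _∩_

  _∪_ : List A → List A → List A
  xs ∪ ys = xs ++ filter (∁? (_∈? xs)) ys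

  _∩_ : List A → List A → List A
  xs ∩ ys = filter (_∈? xs) ys

  length-∪+length-∩ : ∀ xs ys → length (xs ∪ ys) + length (xs ∩ ys) ≡ length xs + length ys
  length-∪+length-∩ xs ys = begin
    length (xs ++ new) + length old       ≡⟨ cong (_+ length old) (length-++ xs) ⟩
    length xs + length new + length old   ≡⟨ +-assoc (length xs) _ _ ⟩
    length xs + (length new + length old) ≡⟨ cong (length xs +_) (+-comm (length new) _) ⟩
    length xs + (length old + length new) ≡⟨ cong (length xs +_) (length-filter+length-filter-∁ _ ys) ⟩
    length xs + length ys                 ∎
    where
    open ≡-Reasoning
    new = filter (∁? (_∈? xs)) ys
    old = filter (_∈? xs) ys

  ∈-∪⁺ : ∀ {t} xs {ys} → t ∈ xs ⊎ t ∈ ys → t ∈ xs ∪ ys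
  ∈-∪⁺ xs (inj₁ t∈xs) = ∈-++⁺ˡ setoid t∈xs
  ∈-∪⁺ {t} xs (inj₂ t∈ys) with t ∈? xs
  ... | yes t∈xs = ∈-++⁺ˡ setoid t∈xs
  ... | no  t∉xs = ∈-++⁺ʳ setoid xs (∈-filter⁺ setoid (∁? (_∈? xs)) (∉-resp-≈ setoid) t∈ys t∉xs)

  ∈-∪⁻ : ∀ {t} xs {ys} → t ∈ xs ∪ ys → t ∈ xs ⊎ t ∈ ys
  ∈-∪⁻ xs t∈ = Sum.map₂ (λ t∈new → proj₁ (∈-filter⁻ setoid (∁? (_∈? xs)) (∉-resp-≈ setoid) t∈new))
    (∈-++⁻ setoid xs t∈)

  ∈-∩⁺ : ∀ {t} xs {ys} → t ∈ xs → t ∈ ys → t ∈ xs ∩ ys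
  ∈-∩⁺ xs t∈xs t∈ys = ∈-filter⁺ setoid (_∈? xs) (∈-resp-≈ setoid) t∈ys t∈xs

  ∈-∩⁻ : ∀ {t} xs {ys} → t ∈ xs ∩ ys → t ∈ xs × t ∈ ys
  ∈-∩⁻ xs t∈ = swap (∈-filter⁻ setoid (_∈? xs) (∈-resp-≈ setoid) t∈)

  ∪-Unique : ∀ {xs ys} → Unique xs → Unique ys → Unique (xs ∪ ys)
  ∪-Unique {xs} {ys} xs! ys! = Unique.++⁺ setoid xs! (Unique.filter⁺ setoid (∁? (_∈? xs)) ys!)
    λ (t∈xs , t∈new) → proj₂ (∈-filter⁻ setoid (∁? (_∈? xs)) (∉-resp-≈ setoid) {xs = ys} t∈new) t∈xs

  ∩-Unique : ∀ xs {ys} → Unique ys → Unique (xs ∩ ys)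
  ∩-Unique xs = Unique.filter⁺ setoid (_∈? xs)

  length+length<length+length : ∀ {xs ys us vs a} → Unique xs → Unique ys →
    (∀ {t} → t ∈ xs ⊎ t ∈ ys → t ∈ us ⊎ t ∈ vs) →
    (∀ {t} → t ∈ xs → t ∈ ys → t ∈ us × t ∈ vs) →
    a ∈ us ⊎ a ∈ vs → a ∉ xs → a ∉ ys →
    length xs + length ys < length us + length vs
  length+length<length+length {xs} {ys} {us} {vs} {a} xs! ys! ∪⊆∪ ∩⊆∩ a∈ a∉xs a∉ys =
    begin-strict
    length xs + length ys               ≡⟨ sym (length-∪+length-∩ xs ys) ⟩
    length (xs ∪ ys) + length (xs ∩ ys) <⟨ +-mono-<-≤ union-grows intersection-grows ⟩
    length (us ∪ vs) + length (us ∩ vs) ≡⟨ length-∪+length-∩ us vs ⟩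
    length us + length vs               ∎
    where
    open ≤-Reasoning
    a∉xs∪ys : a ∉ xs ∪ ys
    a∉xs∪ys a∈xs∪ys = [ a∉xs , a∉ys ] (∈-∪⁻ xs a∈xs∪ys)
    union-grows : length (a ∷ xs ∪ ys) ≤ length (us ∪ vs)
    union-grows = Unique⇒length≤ (us ∪ vs) (∉⇒All[≉] setoid a∉xs∪ys ∷ ∪-Unique xs! ys!) λ where
      (here t≈a)      → ∈-resp-≈ setoid (≈-sym t≈a) (∈-∪⁺ us a∈)
      (there t∈xs∪ys) → ∈-∪⁺ us (∪⊆∪ (∈-∪⁻ xs t∈xs∪ys))
    intersection-grows : length (xs ∩ ys) ≤ length (us ∩ vs)
    intersection-grows = Unique⇒length≤ (us ∩ vs) (∩-Unique xs ys!) λ t∈xs∩ys →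
      let t∈us , t∈vs = Product.uncurry ∩⊆∩ (∈-∩⁻ xs t∈xs∩ys) in ∈-∩⁺ us t∈us t∈vs

open import Data.Fin.Subset using (_⊆_; _∩_; _∪_)
open import Data.Fin.Subset.Properties using (_⊆?_; p∩q⊆p; p∩q⊆q; p⊆p∪q; q⊆p∪q; x∈p∩q⁺; x∈p∪q⁻)

module _ {n : ℕ} where

  private variable t u v : Pair n

  infix  4 _≼_ _≼?_
  infixr 7 _∧_

  _≼_ : Pair n → Pair n → Set
  (A , B) ≼ (C , D) = A ⊆ C × D ⊆ B

  _≼?_ : (t u : Pair n) → Dec (t ≼ u)
  (A , B) ≼? (C , D) = A ⊆? C ×-dec D ⊆? B

  _∧_ : Pair n → Pair n → Pair n
  (A , B) ∧ (C , D) = A ∩ C , B ∪ D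

  ≼-trans : t ≼ u → u ≼ v → t ≼ v
  ≼-trans (A⊆C , D⊆B) (C⊆E , F⊆D) = (λ x∈A → C⊆E (A⊆C x∈A)) , (λ x∈F → D⊆B (F⊆D x∈F))

  ≼-reverse : t ≼ u → swap u ≼ swap t
  ≼-reverse = swap

  r∧s≼r : ∀ r s → r ∧ s ≼ r
  r∧s≼r (A , B) (C , D) = p∩q⊆p A C , p⊆p∪q D

  r∧s≼s : ∀ r s → r ∧ s ≼ s
  r∧s≼s (A , B) (C , D) = p∩q⊆q A C , q⊆p∪q B D

  ∧-greatest : ∀ {r s} → t ≼ r → t ≼ s → t ≼ r ∧ s
  ∧-greatest (E⊆A , B⊆F) (E⊆C , D⊆F) =
    (λ x∈E → x∈p∩q⁺ (E⊆A x∈E , E⊆C x∈E)) , (λ x∈B∪D → [ B⊆F , D⊆F ] (x∈p∪q⁻ _ _ x∈B∪D))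

  -- Nested t u unfolds to  t ≼ u ⊎ swap t ≼ u ⊎ t ≼ swap u ⊎ swap t ≼ swap u.
  ≼⇒Nested : t ≼ u → Nested t u
  ≼⇒Nested = inj₁

  Nested-sym : Nested t u → Nested u t
  Nested-sym (inj₁ t≼u)                   = inj₂ (inj₂ (inj₂ (≼-reverse t≼u)))
  Nested-sym (inj₂ (inj₁ t*≼u))           = inj₂ (inj₁ (≼-reverse t*≼u))
  Nested-sym (inj₂ (inj₂ (inj₁ t≼u*)))    = inj₂ (inj₂ (inj₁ (≼-reverse t≼u*)))
  Nested-sym (inj₂ (inj₂ (inj₂ t*≼u*)))   = inj₁ (≼-reverse t*≼u*)

  Nested-swapʳ : Nested t u → Nested t (swap u)
  Nested-swapʳ (inj₁ t≼u)                 = inj₂ (inj₂ (inj₁ t≼u))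
  Nested-swapʳ (inj₂ (inj₁ t*≼u))         = inj₂ (inj₂ (inj₂ t*≼u))
  Nested-swapʳ (inj₂ (inj₂ (inj₁ t≼u*)))  = inj₁ t≼u*
  Nested-swapʳ (inj₂ (inj₂ (inj₂ t*≼u*))) = inj₂ (inj₁ t*≼u*)

  Nested-swapˡ : Nested t u → Nested (swap t) u
  Nested-swapˡ t∥u = Nested-sym (Nested-swapʳ (Nested-sym t∥u))

  Nested? : (t u : Pair n) → Dec (Nested t u)
  Nested? t u = t ≼? u ⊎-dec swap t ≼? u ⊎-dec t ≼? swap u ⊎-dec swap t ≼? swap u

  Crosses-sym : Crosses t u → Crosses u t
  Crosses-sym t×u u∥t = t×u (Nested-sym u∥t)

  Crosses-swapˡ : Crosses t u → Crosses (swap t) u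
  Crosses-swapˡ t×u t*∥u = t×u (Nested-swapˡ t*∥u)

  Crosses-swapʳ : Crosses t u → Crosses t (swap u)
  Crosses-swapʳ t×u t∥u* = t×u (Nested-swapʳ t∥u*)

  ∧-Nested : ∀ r s {t : Pair n} → Crosses r s → Nested r t → Nested s t → Nested (r ∧ s) t
  ∧-Nested r s _ (inj₁ r≼t) _ = inj₁ (≼-trans (r∧s≼r r s) r≼t)
  ∧-Nested r s _ (inj₂ (inj₂ (inj₁ r≼t*))) _ = inj₂ (inj₂ (inj₁ (≼-trans (r∧s≼r r s) r≼t*)))
  ∧-Nested r s _ _ (inj₁ s≼t) = inj₁ (≼-trans (r∧s≼s r s) s≼t)
  ∧-Nested r s _ _ (inj₂ (inj₂ (inj₁ s≼t*))) = inj₂ (inj₂ (inj₁ (≼-trans (r∧s≼s r s) s≼t*)))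
  ∧-Nested r s _ (inj₂ (inj₁ r*≼t)) (inj₂ (inj₁ s*≼t)) =
    inj₂ (inj₁ (≼-reverse (∧-greatest (≼-reverse r*≼t) (≼-reverse s*≼t))))
  ∧-Nested r s _ (inj₂ (inj₂ (inj₂ r*≼t*))) (inj₂ (inj₂ (inj₂ s*≼t*))) =
    inj₂ (inj₂ (inj₂ (≼-reverse (∧-greatest (≼-reverse r*≼t*) (≼-reverse s*≼t*)))))
  ∧-Nested r s r×s (inj₂ (inj₁ r*≼t)) (inj₂ (inj₂ (inj₂ s*≼t*))) =
    contradiction (inj₂ (inj₁ (≼-trans r*≼t (≼-reverse s*≼t*)))) r×s
  ∧-Nested r s r×s (inj₂ (inj₂ (inj₂ r*≼t*))) (inj₂ (inj₁ s*≼t)) =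
    contradiction (inj₂ (inj₁ (≼-reverse (≼-trans s*≼t (≼-reverse r*≼t*))))) r×s

  Nested-≼-either : ∀ {r} → u ≼ r → v ≼ swap r → Nested r t → Nested u t ⊎ Nested v t
  Nested-≼-either u≼r _    (inj₁ r≼t)                 = inj₁ (inj₁ (≼-trans u≼r r≼t))
  Nested-≼-either _   v≼r* (inj₂ (inj₁ r*≼t))         = inj₂ (inj₁ (≼-trans v≼r* r*≼t))
  Nested-≼-either u≼r _    (inj₂ (inj₂ (inj₁ r≼t*)))  = inj₁ (inj₂ (inj₂ (inj₁ (≼-trans u≼r r≼t*))))
  Nested-≼-either _   v≼r* (inj₂ (inj₂ (inj₂ r*≼t*))) = inj₂ (inj₂ (inj₂ (inj₁ (≼-trans v≼r* r*≼t*))))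

  Crosses-∧ : ∀ r s {t : Pair n} → Crosses r s → Crosses (r ∧ s) t → Crosses r t ⊎ Crosses s t
  Crosses-∧ r s {t} r×s r∧s×t with Nested? r t | Nested? s t
  ... | no r×t  | _        = inj₁ r×t
  ... | yes _   | no s×t   = inj₂ s×t
  ... | yes r∥t | yes s∥t  = contradiction (∧-Nested r s r×s r∥t s∥t) r∧s×t

  Crosses-swap∧swap : ∀ r s {t : Pair n} → Crosses r s → Crosses (swap r ∧ swap s) t →
    Crosses r t ⊎ Crosses s t
  Crosses-swap∧swap r s r×s d×t = Sum.map Crosses-swapˡ Crosses-swapˡ
    (Crosses-∧ (swap r) (swap s) (Crosses-swapˡ (Crosses-swapʳ r×s)) d×t)

  Crosses-opposite-corners : ∀ r s {t : Pair n} → Crosses (r ∧ s) t → Crosses (swap r ∧ swap s) t →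
    Crosses r t × Crosses s t
  Crosses-opposite-corners r s c×t d×t =
    (λ r∥t → [ c×t , d×t ] (Nested-≼-either (r∧s≼r r s) (r∧s≼r (swap r) (swap s)) r∥t)) ,
    (λ s∥t → [ c×t , d×t ] (Nested-≼-either (r∧s≼s r s) (r∧s≼s (swap r) (swap s)) s∥t))

  SameSep-sym : SameSep t u → SameSep u t
  SameSep-sym (inj₁ refl) = inj₁ refl
  SameSep-sym (inj₂ refl) = inj₂ refl

  SameSep-trans : SameSep t u → SameSep u v → SameSep t v
  SameSep-trans (inj₁ refl) u≈v         = u≈v
  SameSep-trans (inj₂ refl) (inj₁ refl) = inj₂ refl
  SameSep-trans (inj₂ refl) (inj₂ refl) = inj₁ refl

  SameSep? : (t u : Pair n) → Dec (SameSep t u)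
  SameSep? t u = ≡-dec t u ⊎-dec ≡-dec (swap t) u
    where
    ≡-dec : (t u : Pair n) → Dec (t ≡ u)
    ≡-dec = ×-≡-dec (Vec-≡-dec Bool-≟) (Vec-≡-dec Bool-≟)

  separationDecSetoid : DecSetoid _ _
  separationDecSetoid = record
    { Carrier = Pair n
    ; _≈_ = SameSep
    ; isDecEquivalence = record
      { isEquivalence = record { refl = inj₁ refl ; sym = SameSep-sym ; trans = SameSep-trans }
      ; _≟_ = SameSep?
      }
    }

  open UniqueCounting separationDecSetoid using (length+length<length+length)
  open import Data.List.Membership.DecSetoid separationDecSetoid using (_∈_; _∉_)

  swap-Respects : ∀ {ℓ} (P : Pair n → Set ℓ) → (∀ {t} → P t → P (swap t)) → P Respects SameSep
  swap-Respects P P-swap (inj₁ refl) = λ Pt → Pt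
  swap-Respects P P-swap (inj₂ refl) = P-swap

  InSomeEntanglement-swap : ∀ G → InSomeEntanglement G t → InSomeEntanglement G (swap t)
  InSomeEntanglement-swap G (ε , ε-entanglement , t∈ε) = ε , ε-entanglement , Sum.swap t∈ε

  XIs-swap : ∀ G {k} → XIs G t k → XIs G (swap t) k
  XIs-swap G (L , L-crossed , L-complete , L! , |L|≡k) =
    L , All.map (map₂ Crosses-swapˡ) L-crossed ,
    (λ u u-ent t*×u → L-complete u u-ent (Crosses-swapˡ t*×u)) , L! , |L|≡k

  module _ (G : Graph n) {p : Pair n} {k : ℕ} (X : XIs G p k) where

    ∈-XIs⁺ : InSomeEntanglement G t → Crosses p t → t ∈ proj₁ X
    ∈-XIs⁺ {t} t-ent p×t with proj₁ (proj₂ (proj₂ X)) t t-ent p×t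
    ... | inj₁ t∈L  = Any.map inj₁ t∈L
    ... | inj₂ t*∈L = Any.map inj₂ t*∈L

    ∈-XIs⁻ : t ∈ proj₁ X → InSomeEntanglement G t × Crosses p t
    ∈-XIs⁻ = All.lookupₛ (DecSetoid.setoid separationDecSetoid)
      (swap-Respects _ (Product.map (InSomeEntanglement-swap G) Crosses-swapʳ)) (proj₁ (proj₂ X))

  x-opposite-corners< : ∀ (G : Graph n) r s {xr xs xc xd} → Crosses r s →
    InSomeEntanglement G r → InSomeEntanglement G s →
    XIs G r xr → XIs G s xs → XIs G (r ∧ s) xc → XIs G (swap r ∧ swap s) xd →
    xc + xd < xr + xs
  x-opposite-corners< G r s r×s r-ent s-ent
    Xr@(R , _ , _ , _ , refl) Xs@(S , _ , _ , _ , refl)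
    Xc@(C , _ , _ , C! , refl) Xd@(D , _ , _ , D! , refl) =
    length+length<length+length C! D! covered shared (inj₂ r∈S) r∉C r∉D
    where
    counted : ∀ {t} → Crosses r t ⊎ Crosses s t → InSomeEntanglement G t → t ∈ R ⊎ t ∈ S
    counted r×t⊎s×t t-ent = Sum.map (∈-XIs⁺ G Xr t-ent) (∈-XIs⁺ G Xs t-ent) r×t⊎s×t
    covered : ∀ {t} → t ∈ C ⊎ t ∈ D → t ∈ R ⊎ t ∈ S
    covered (inj₁ t∈C) = let t-ent , c×t = ∈-XIs⁻ G Xc t∈C in
      counted (Crosses-∧ r s r×s c×t) t-ent
    covered (inj₂ t∈D) = let t-ent , d×t = ∈-XIs⁻ G Xd t∈D in
      counted (Crosses-swap∧swap r s r×s d×t) t-ent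
    shared : ∀ {t} → t ∈ C → t ∈ D → t ∈ R × t ∈ S
    shared t∈C t∈D =
      let t-ent , c×t = ∈-XIs⁻ G Xc t∈C
          r×t , s×t   = Crosses-opposite-corners r s c×t (proj₂ (∈-XIs⁻ G Xd t∈D))
      in ∈-XIs⁺ G Xr t-ent r×t , ∈-XIs⁺ G Xs t-ent s×t
    r∈S : r ∈ S
    r∈S = ∈-XIs⁺ G Xs r-ent (Crosses-sym r×s)
    r∉C : r ∉ C
    r∉C r∈C = proj₂ (∈-XIs⁻ G Xc r∈C) (≼⇒Nested (r∧s≼r r s))
    r∉D : r ∉ D
    r∉D r∈D = proj₂ (∈-XIs⁻ G Xd r∈D) (Nested-swapʳ (≼⇒Nested (r∧s≼r (swap r) (swap s))))

corollary3p3 : ∀ {n} (G : Graph n) (r s c d : Pair n) (xr xs xc xd : ℕ) →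
    IsSep G r → IsSep G s → Crosses r s →
    InSomeEntanglement G r → InSomeEntanglement G s →
    Opposite r s c d →
    XIs G r xr → XIs G s xs → XIs G c xc → XIs G d xd →
    xc + xd < xr + xs
corollary3p3 G r s _ _ xr xs xc xd _ _ r×s r-ent s-ent opposite Xr Xs = corners opposite
  where
  bound : ∀ {xc xd} → XIs G (r ∧ s) xc → XIs G (swap r ∧ swap s) xd → xc + xd < xr + xs
  bound = x-opposite-corners< G r s r×s r-ent s-ent Xr Xs
  bound* : ∀ {xc xd} → XIs G (r ∧ swap s) xc → XIs G (swap r ∧ s) xd → xc + xd < xr + xs
  bound* = x-opposite-corners< G r (swap s) (Crosses-swapʳ r×s) r-ent
    (InSomeEntanglement-swap G s-ent) Xr (XIs-swap G Xs)
  commute : xd + xc < xr + xs → xc + xd < xr + xs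
  commute = subst (_< xr + xs) (+-comm xd xc)
  corners : ∀ {c d} → Opposite r s c d → XIs G c xc → XIs G d xd → xc + xd < xr + xs
  corners (inj₁ (refl , refl))               Xc Xd = bound Xc Xd
  corners (inj₂ (inj₁ (refl , refl)))        Xc Xd = commute (bound Xd Xc)
  corners (inj₂ (inj₂ (inj₁ (refl , refl)))) Xc Xd = bound* Xc Xd
  corners (inj₂ (inj₂ (inj₂ (refl , refl)))) Xc Xd = commute (bound* Xd Xc)
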